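{- Let $F$ be a finite field with $q$ elements and let $V$ be a vector space over $F$ of finite dimension $n\ge 1$. Then the number of edges of the linear dependence graph $\Gamma(V)$ is $\frac{q(q^n-1)}{2}$.
   Context: For a finite-dimensional vector space $V$ over a finite field $F$, the linear dependence graph $\Gamma(V)$ is the simple graph whose vertex set is $V$, two vertices $a,b$ being adjacent if and only if $a\neq b$ and $\{a,b\}$ is linearly dependent. -}

module Defs where

open import Level using (Level; _⊔_)
open import Data.Nat using (ℕ; zero; suc)
open import Data.Fin using (Fin; zero; suc; _<_)
open import Data.Fin.Properties using (_≟_; _<?_; any?)
open import Data.List using (List; length; filter; allFin; cartesianProduct)
open import Data.Product using (Σ; ∃; _×_; _,_; proj₁; proj₂)
open import Data.Empty using (⊥)
open import Relation.Nullary using (¬_; Dec; yes; no)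
open import Relation.Nullary.Decidable using (_×-dec_; ¬?)
open import Relation.Binary.PropositionalEquality using (_≡_; refl; subst) renaming (sym to sym')
open import Algebra.Bundles using (CommutativeRing)
open import Algebra.Module.Bundles using (Module)

private variable c ℓ m ℓm : Level

record IsField (R : CommutativeRing c ℓ) : Set (c ⊔ ℓ) where
  open CommutativeRing R
  field
    1≉0 : ¬ (1# ≈ 0#)
    inverse : ∀ x → ¬ (x ≈ 0#) → ∃ λ y → (x * y) ≈ 1#

record HasCard {a r : Level} (A : Set a) (_≈_ : A → A → Set r) (k : ℕ) : Set (a ⊔ r) where
  field
    enum       : Fin k → A
    enum-inj   : ∀ i j → enum i ≈ enum j → i ≡ j
    index      : A → Fin k
    enum-index : ∀ x → enum (index x) ≈ x

module _ {R : CommutativeRing c ℓ} (V : Module R m ℓm) where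
  open CommutativeRing R hiding (zero)
  open Module V

  lincomb : ∀ {n} → (Fin n → Carrier) → (Fin n → Carrierᴹ) → Carrierᴹ
  lincomb {zero}  cs bs = 0ᴹ
  lincomb {suc n} cs bs = (cs zero *ₗ bs zero) +ᴹ lincomb (λ i → cs (suc i)) (λ i → bs (suc i))

  record Basis (n : ℕ) : Set (c ⊔ ℓ ⊔ m ⊔ ℓm) where
    field
      vec       : Fin n → Carrierᴹ
      spanning  : ∀ v → ∃ λ (cs : Fin n → Carrier) → v ≈ᴹ lincomb cs vec
      independent : ∀ (cs : Fin n → Carrier) → lincomb cs vec ≈ᴹ 0ᴹ → ∀ i → cs i ≈ 0#

  HasDim : ℕ → Set (c ⊔ ℓ ⊔ m ⊔ ℓm)
  HasDim n = Basis n

  LinDep : Carrierᴹ → Carrierᴹ → Set (c ⊔ ℓ ⊔ ℓm)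
  LinDep a b = ∃ λ (αβ : Carrier × Carrier) →
    ¬ ((proj₁ αβ ≈ 0#) × (proj₂ αβ ≈ 0#)) × ((proj₁ αβ *ₗ a) +ᴹ (proj₂ αβ *ₗ b)) ≈ᴹ 0ᴹ

  Adjacent : Carrierᴹ → Carrierᴹ → Set (c ⊔ ℓ ⊔ ℓm)
  Adjacent a b = ¬ (a ≈ᴹ b) × LinDep a b

  module Decide {q k : ℕ} (FF : HasCard Carrier _≈_ q) (FV : HasCard Carrierᴹ _≈ᴹ_ k) where
    private
      module F = HasCard FF
      module W = HasCard FV

    ≈?F : ∀ x y → Dec (x ≈ y)
    ≈?F x y with F.index x ≟ F.index y
    ... | yes p = yes (trans (sym (F.enum-index x)) (subst (λ i → F.enum i ≈ y) (sym' p) (F.enum-index y)))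
    ... | no ¬p = no λ x≈y → ¬p (F.enum-inj _ _
                      (trans (F.enum-index x) (trans x≈y (sym (F.enum-index y)))))

    ≈?V : ∀ x y → Dec (x ≈ᴹ y)
    ≈?V x y with W.index x ≟ W.index y
    ... | yes p = yes (≈ᴹ-trans (≈ᴹ-sym (W.enum-index x)) (subst (λ i → W.enum i ≈ᴹ y) (sym' p) (W.enum-index y)))
    ... | no ¬p = no λ x≈y → ¬p (W.enum-inj _ _
                      (≈ᴹ-trans (W.enum-index x) (≈ᴹ-trans x≈y (≈ᴹ-sym (W.enum-index y)))))

    private
      Good : Carrierᴹ → Carrierᴹ → Carrier × Carrier → Set (ℓ ⊔ ℓm)
      Good a b αβ = ¬ ((proj₁ αβ ≈ 0#) × (proj₂ αβ ≈ 0#)) × ((proj₁ αβ *ₗ a) +ᴹ (proj₂ αβ *ₗ b)) ≈ᴹ 0ᴹ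

      good? : ∀ a b αβ → Dec (Good a b αβ)
      good? a b (α , β) = ¬? (≈?F α 0# ×-dec ≈?F β 0#) ×-dec ≈?V _ 0ᴹ

      Good-resp : ∀ a b {α β α' β'} → α ≈ α' → β ≈ β' → Good a b (α , β) → Good a b (α' , β')
      Good-resp a b α≈ β≈ (nz , eq) =
        (λ { (z1 , z2) → nz (trans α≈ z1 , trans β≈ z2) }) ,
        ≈ᴹ-trans (+ᴹ-cong (*ₗ-congʳ (sym α≈)) (*ₗ-congʳ (sym β≈))) eq

    linDep? : ∀ a b → Dec (LinDep a b)
    linDep? a b with any? (λ i → any? (λ j → good? a b (F.enum i , F.enum j)))
    ... | yes (i , j , g) = yes ((F.enum i , F.enum j) , g)
    ... | no ¬e = no λ { ((α , β) , g) → ¬e (F.index α , F.index β ,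
                  Good-resp a b (sym (F.enum-index α)) (sym (F.enum-index β)) g) }

    adjacent? : ∀ a b → Dec (Adjacent a b)
    adjacent? a b = ¬? (≈?V a b) ×-dec linDep? a b

    -- Number of edges of Γ(V): unordered pairs {a , b} of vertices that are adjacent,
    -- counted as index pairs i < j under the enumeration of V.
    edgeCount : ℕ
    edgeCount = length (filter (λ p → (proj₁ p <? proj₂ p) ×-dec
                                       adjacent? (W.enum (proj₁ p)) (W.enum (proj₂ p)))
                                (cartesianProduct (allFin k) (allFin k)))

-- Coordinates in a basis give |V| = qⁿ.  In Γ(V) the zero vector is adjacent
-- to every other vector, while a nonzero vector a is adjacent exactly to the
-- q - 1 other points λ a of its line.  By the handshake lemma, twice the number
-- of edges is (qⁿ - 1) + (qⁿ - 1)(q - 1) = q (qⁿ - 1).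
module Submission where

open import Level using (Level; _⊔_)
open import Function using (_∘_; id; Injective)
open import Data.Nat using (ℕ; zero; suc; _+_; _*_; _∸_; _^_; _/_; _≤_; _≥_)
open import Data.Nat.Properties
  using (+-assoc; +-comm; +-identityʳ; *-zeroʳ; +-cancelʳ-≡; m+n∸n≡m; ≤-antisym; +-commutativeSemigroup; +-0-commutativeMonoid)
open import Algebra.Properties.CommutativeSemigroup +-commutativeSemigroup using (x∙yz≈y∙xz)
open import Data.Nat.DivMod using (m*n/n≡m)
open import Data.Nat.Tactic.RingSolver using (solve-∀)
open import Data.Fin using (Fin; zero; suc; _<_; combine; funToFin; finToFun)
open import Data.Fin.Properties
  using (_≟_; _<?_; any?; suc-injective; <-cmp; <-asym; injective⇒≤; funToFin-finToFin; finToFun-funToFin)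
open import Data.List using (List; []; _∷_; _++_; length; filter; map; tabulate; allFin; cartesianProduct)
open import Data.List.Properties using (length-++; filter-++)
open import Data.Vec.Functional using (Vector)
open import Data.Vec.Functional.Relation.Binary.Pointwise using (Pointwise)
open import Data.Product using (∃; _×_; _,_; proj₁; proj₂; map₂)
open import Data.Sum using (_⊎_; inj₁; inj₂)
open import Data.Empty using (⊥-elim)
open import Data.Unit using (⊤; tt)
open import Relation.Nullary using (¬_; Dec; yes; no)
open import Relation.Nullary.Decidable using (_×-dec_; _⊎-dec_; ¬?)
open import Relation.Unary using (Pred; Decidable)
open import Relation.Binary.Core using (Rel)
open import Relation.Binary.Bundles using (Setoid)
open import Relation.Binary.Definitions using (tri<; tri≈; tri>)
open import Relation.Binary.PropositionalEquality
  using (_≡_; _≢_; refl; sym; trans; cong; cong₂; subst; module ≡-Reasoning)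
open import Algebra.Bundles using (CommutativeRing)
open import Algebra.Module.Bundles using (Module)
open import Algebra.Properties.CommutativeMonoid.Sum +-0-commutativeMonoid
  using (sum; ∑-comm; ∑-distrib-+; sum-cong-≗)
open import Defs

private variable
  a p p′ : Level
  A : Set a
  k m n : ℕ

m+1≡n⇒m≡n∸1 : ∀ {m n} → m + 1 ≡ n → m ≡ n ∸ 1
m+1≡n⇒m≡n∸1 {m} refl = sym (m+n∸n≡m m 1)

-- The Fin witnesses only serve to exclude q = 0 and k = 0.
solve-degreeSum : ∀ {q k} T → Fin q → Fin k → T + (q ∸ 1) ≡ (k ∸ 1) + k * (q ∸ 1) → T ≡ q * (k ∸ 1)
solve-degreeSum {suc q′} {suc k′} T _ _ eq = +-cancelʳ-≡ q′ T (suc q′ * k′) (trans eq (rearrange q′ k′))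
  where
  rearrange : ∀ q′ k′ → k′ + suc k′ * q′ ≡ suc q′ * k′ + q′
  rearrange = solve-∀

m+m≡n⇒n/2≡m : ∀ {m n} → m + m ≡ n → n / 2 ≡ m
m+m≡n⇒n/2≡m {m} refl = trans (cong (_/ 2) (double m)) (m*n/n≡m m 2)
  where
  double : ∀ m → m + m ≡ m * 2
  double = solve-∀

-- Counting

indicator : {P : Set p} → Dec P → ℕ
indicator (yes _) = 1
indicator (no _)  = 0

indicator-yes : {P : Set p} → P → (P? : Dec P) → indicator P? ≡ 1
indicator-yes _  (yes _) = refl
indicator-yes pf (no ¬p) = ⊥-elim (¬p pf)

indicator-no : {P : Set p} → ¬ P → (P? : Dec P) → indicator P? ≡ 0
indicator-no ¬p (yes pf) = ⊥-elim (¬p pf)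
indicator-no _  (no _)   = refl

indicator-cong : {P : Set p} {Q : Set p′} → (P → Q) → (Q → P) →
                 (P? : Dec P) (Q? : Dec Q) → indicator P? ≡ indicator Q?
indicator-cong P⇒Q Q⇒P (yes pf) Q? = sym (indicator-yes (P⇒Q pf) Q?)
indicator-cong P⇒Q Q⇒P (no ¬p)  Q? = sym (indicator-no (¬p ∘ Q⇒P) Q?)

indicator-⊎ : {P : Set p} {Q : Set p′} (P? : Dec P) (Q? : Dec Q) → ¬ (P × Q) →
              indicator (P? ⊎-dec Q?) ≡ indicator P? + indicator Q?
indicator-⊎ (yes pf) (yes qf) disjoint = ⊥-elim (disjoint (pf , qf))
indicator-⊎ (yes _)  (no _)   _        = refl
indicator-⊎ (no _)   (yes _)  _        = refl
indicator-⊎ (no _)   (no _)   _        = refl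

count : {P : Pred (Fin k) p} → Decidable P → ℕ
count P? = sum (λ i → indicator (P? i))

module _ {P : Pred (Fin k) p} where

  count-cong : {Q : Pred (Fin k) p′} → (∀ {i} → P i → Q i) → (∀ {i} → Q i → P i) →
               (P? : Decidable P) (Q? : Decidable Q) → count P? ≡ count Q?
  count-cong P⇒Q Q⇒P P? Q? = sum-cong-≗ (λ i → indicator-cong P⇒Q Q⇒P (P? i) (Q? i))

  count-⊎ : {Q : Pred (Fin k) p′} → (∀ i → ¬ (P i × Q i)) → (P? : Decidable P) (Q? : Decidable Q) →
            count (λ i → P? i ⊎-dec Q? i) ≡ count P? + count Q?
  count-⊎ disjoint P? Q? = trans (sum-cong-≗ (λ i → indicator-⊎ (P? i) (Q? i) (disjoint i)))
                                   (∑-distrib-+ (λ i → indicator (P? i)) (λ i → indicator (Q? i)))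

count-all : {P : Pred (Fin k) p} (P? : Decidable P) → (∀ i → P i) → count P? ≡ k
count-all {k = zero}  P? all = refl
count-all {k = suc k} P? all = cong₂ _+_ (indicator-yes (all zero) (P? zero)) (count-all (P? ∘ suc) (all ∘ suc))

count-none : {P : Pred (Fin k) p} (P? : Decidable P) → (∀ i → ¬ P i) → count P? ≡ 0
count-none {k = zero}  P? none = refl
count-none {k = suc k} P? none = cong₂ _+_ (indicator-no (none zero) (P? zero)) (count-none (P? ∘ suc) (none ∘ suc))

sum-constExcept : (f : Vector ℕ k) (i : Fin k) {c : ℕ} → (∀ j → j ≢ i → f j ≡ c) → sum f + c ≡ f i + k * c
sum-constExcept {suc k} f zero {c} f≡c = begin
  f zero + sum (f ∘ suc) + c   ≡⟨ +-assoc (f zero) _ c ⟩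
  f zero + (sum (f ∘ suc) + c) ≡⟨ cong (λ s → f zero + (s + c)) (sum-const (f ∘ suc) (λ j → f≡c (suc j) λ ())) ⟩
  f zero + (k * c + c)         ≡⟨ cong (f zero +_) (+-comm (k * c) c) ⟩
  f zero + suc k * c           ∎
  where
  open ≡-Reasoning
  sum-const : ∀ {k} (g : Vector ℕ k) → (∀ j → g j ≡ c) → sum g ≡ k * c
  sum-const {zero}  g g≡c = refl
  sum-const {suc k} g g≡c = cong₂ _+_ (g≡c zero) (sum-const (g ∘ suc) (g≡c ∘ suc))
sum-constExcept {suc k} f (suc i) {c} f≡c = begin
  f zero + sum (f ∘ suc) + c   ≡⟨ +-assoc (f zero) _ c ⟩
  f zero + (sum (f ∘ suc) + c) ≡⟨ cong₂ _+_ (f≡c zero λ ()) (sum-constExcept (f ∘ suc) i (λ j j≢i → f≡c (suc j) (j≢i ∘ suc-injective))) ⟩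
  c + (f (suc i) + k * c)      ≡⟨ x∙yz≈y∙xz c (f (suc i)) (k * c) ⟩
  f (suc i) + suc k * c        ∎
  where open ≡-Reasoning

count-≡ : (i : Fin k) → count (_≟ i) ≡ 1
count-≡ {k} i = begin
  count (_≟ i)               ≡⟨ +-identityʳ _ ⟨
  count (_≟ i) + 0           ≡⟨ sum-constExcept _ i (λ j j≢i → indicator-no j≢i (j ≟ i)) ⟩
  indicator (i ≟ i) + k * 0  ≡⟨ cong₂ _+_ (indicator-yes refl (i ≟ i)) (*-zeroʳ k) ⟩
  1                          ∎
  where open ≡-Reasoning

count-remove : {P : Pred (Fin k) p} (P? : Decidable P) {i : Fin k} → P i →
               count (λ j → P? j ×-dec ¬? (j ≟ i)) + 1 ≡ count P?
count-remove {P = P} P? {i} Pi = begin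
  count P∖i? + 1                            ≡⟨ cong (count P∖i? +_) (sym (count-≡ i)) ⟩
  count P∖i? + count (_≟ i)                 ≡⟨ sym (count-⊎ (λ j (P∖i , j≡i) → proj₂ P∖i j≡i) P∖i? (_≟ i)) ⟩
  count (λ j → P∖i? j ⊎-dec (j ≟ i))        ≡⟨ count-cong merge split _ P? ⟩
  count P? ∎
  where
  open ≡-Reasoning
  P∖i? : Decidable (λ j → P j × j ≢ i)
  P∖i? j = P? j ×-dec ¬? (j ≟ i)
  merge : ∀ {j} → (P j × j ≢ i) ⊎ j ≡ i → P j
  merge (inj₁ (Pj , _)) = Pj
  merge (inj₂ refl)     = Pi
  split : ∀ {j} → P j → (P j × j ≢ i) ⊎ j ≡ i
  split {j} Pj with j ≟ i
  ... | yes j≡i = inj₂ j≡i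
  ... | no j≢i  = inj₁ (Pj , j≢i)

count-image : (g : Fin m → Fin k) → Injective _≡_ _≡_ g → count (λ j → any? (λ l → j ≟ g l)) ≡ m
count-image {zero} g _ = count-none (λ j → any? (λ l → j ≟ g l)) (λ j → λ { (() , _) })
count-image {suc m} g g-inj = begin
  count (λ j → any? (λ l → j ≟ g l))
    ≡⟨ count-cong split merge _ (λ j → (j ≟ g zero) ⊎-dec any? (λ l → j ≟ g (suc l))) ⟩
  count (λ j → (j ≟ g zero) ⊎-dec any? (λ l → j ≟ g (suc l)))
    ≡⟨ count-⊎ disjoint (_≟ g zero) (λ j → any? (λ l → j ≟ g (suc l))) ⟩
  count (_≟ g zero) + count (λ j → any? (λ l → j ≟ g (suc l)))
    ≡⟨ cong₂ _+_ (count-≡ (g zero)) (count-image (g ∘ suc) (suc-injective ∘ g-inj)) ⟩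
  suc m ∎
  where
  open ≡-Reasoning
  split : ∀ {j} → ∃ (λ l → j ≡ g l) → j ≡ g zero ⊎ ∃ (λ l → j ≡ g (suc l))
  split (zero  , eq) = inj₁ eq
  split (suc l , eq) = inj₂ (l , eq)
  merge : ∀ {j} → j ≡ g zero ⊎ ∃ (λ l → j ≡ g (suc l)) → ∃ (λ l → j ≡ g l)
  merge (inj₁ eq)       = zero , eq
  merge (inj₂ (l , eq)) = suc l , eq
  disjoint : ∀ j → ¬ (j ≡ g zero × ∃ (λ l → j ≡ g (suc l)))
  disjoint j (eq₀ , l , eq) with g-inj (trans (sym eq₀) eq)
  ... | ()

module _ {R : Fin k → Fin k → Set p} (R? : ∀ i j → Dec (R i j)) where

  countPairs< : ℕ
  countPairs< = sum (λ i → count (λ j → (i <? j) ×-dec R? i j))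

  handshake : (∀ {i j} → R i j → R j i) → (∀ {i} → ¬ R i i) → sum (λ i → count (R? i)) ≡ countPairs< + countPairs<
  handshake R-sym R-irrefl = begin
    sum (λ i → count (R? i))                         ≡⟨ sum-cong-≗ (λ i → count-cong split merge (R? i) (λ j → up i j ⊎-dec down i j)) ⟩
    sum (λ i → count (λ j → up i j ⊎-dec down i j))  ≡⟨ sum-cong-≗ (λ i → count-⊎ (λ j (u , d) → <-asym (proj₁ u) (proj₁ d)) (up i) (down i)) ⟩
    sum (λ i → count (up i) + count (down i))        ≡⟨ ∑-distrib-+ (λ i → count (up i)) (λ i → count (down i)) ⟩
    countPairs< + sum (λ i → count (down i))         ≡⟨ cong (countPairs< +_) (∑-comm (λ i j → indicator (down i j))) ⟩
    countPairs< + sum (λ j → count (λ i → down i j)) ≡⟨ cong (countPairs< +_) (sum-cong-≗ (λ j → count-cong (map₂ R-sym) (map₂ R-sym) _ (up j))) ⟩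
    countPairs< + countPairs<                        ∎
    where
    open ≡-Reasoning
    up : ∀ i j → Dec (i < j × R i j)
    up i j = (i <? j) ×-dec R? i j
    down : ∀ i j → Dec (j < i × R i j)
    down i j = (j <? i) ×-dec R? i j
    split : ∀ {i j} → R i j → (i < j × R i j) ⊎ (j < i × R i j)
    split {i} {j} r with <-cmp i j
    ... | tri< i<j _ _ = inj₁ (i<j , r)
    ... | tri≈ _ refl _ = ⊥-elim (R-irrefl r)
    ... | tri> _ _ j<i = inj₂ (j<i , r)
    merge : ∀ {i j} → (i < j × R i j) ⊎ (j < i × R i j) → R i j
    merge (inj₁ (_ , r)) = r
    merge (inj₂ (_ , r)) = r

length-filter-tabulate : {P : Pred A p} (P? : Decidable P) (f : Fin k → A) →
                         length (filter P? (tabulate f)) ≡ count (P? ∘ f)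
length-filter-tabulate {k = zero}  P? f = refl
length-filter-tabulate {k = suc k} P? f with P? (f zero)
... | yes _ = cong suc (length-filter-tabulate P? (f ∘ suc))
... | no _  = length-filter-tabulate P? (f ∘ suc)

length-filter-map : ∀ {b} {B : Set b} {P : Pred B p} (P? : Decidable P) (g : A → B) (xs : List A) →
                    length (filter P? (map g xs)) ≡ length (filter (P? ∘ g) xs)
length-filter-map P? g [] = refl
length-filter-map P? g (x ∷ xs) with P? (g x)
... | yes _ = cong suc (length-filter-map P? g xs)
... | no _  = length-filter-map P? g xs

length-filter-cartesianProduct : {A B : Set a} {P : Pred (A × B) p} (P? : Decidable P) (f : Fin k → A) (ys : List B) →
  length (filter P? (cartesianProduct (tabulate f) ys)) ≡ sum (λ i → length (filter (λ y → P? (f i , y)) ys))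
length-filter-cartesianProduct {k = zero}  P? f ys = refl
length-filter-cartesianProduct {k = suc k} {A} {B} P? f ys = begin
  length (filter P? (map (f zero ,_) ys ++ rest))                       ≡⟨ cong length (filter-++ P? (map (f zero ,_) ys) rest) ⟩
  length (filter P? (map (f zero ,_) ys) ++ filter P? rest)             ≡⟨ length-++ (filter P? (map (f zero ,_) ys)) ⟩
  length (filter P? (map (f zero ,_) ys)) + length (filter P? rest)     ≡⟨ cong₂ _+_ (length-filter-map P? (f zero ,_) ys)
                                                                               (length-filter-cartesianProduct P? (f ∘ suc) ys) ⟩
  sum (λ i → length (filter (λ y → P? (f i , y)) ys))                   ∎
  where
  open ≡-Reasoning
  rest : List (A × B)
  rest = cartesianProduct (tabulate (f ∘ suc)) ys

-- Finite setoids

module FiniteSetoid {s ℓ} (S : Setoid s ℓ) {k} (finite : HasCard (Setoid.Carrier S) (Setoid._≈_ S) k) where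
  private module S = Setoid S
  open HasCard finite public

  index-injective : ∀ {x y} → index x ≡ index y → x S.≈ y
  index-injective {x} {y} eq = S.trans (S.sym (enum-index x)) (subst (λ i → enum i S.≈ y) (sym eq) (enum-index y))

  index-cong : ∀ {x y} → x S.≈ y → index x ≡ index y
  index-cong {x} {y} x≈y = enum-inj _ _ (S.trans (enum-index x) (S.trans x≈y (S.sym (enum-index y))))

  index-enum : ∀ i → index (enum i) ≡ i
  index-enum i = enum-inj _ _ (enum-index (enum i))

HasCard-injective⇒≤ : ∀ {s ℓ ℓ′} {_≈_ : Rel A ℓ′} (T : Setoid s ℓ) {m k} →
         HasCard A _≈_ m → HasCard (Setoid.Carrier T) (Setoid._≈_ T) k →
         (f : A → Setoid.Carrier T) → (∀ {x y} → Setoid._≈_ T (f x) (f y) → x ≈ y) → m ≤ k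
HasCard-injective⇒≤ T finA finT f f-inj = injective⇒≤ (λ eq → HasCard.enum-inj finA _ _ (f-inj (T.index-injective eq)))
  where module T = FiniteSetoid T finT

funToFin-cong : {f g : Fin m → Fin k} → (∀ i → f i ≡ g i) → funToFin f ≡ funToFin g
funToFin-cong {zero}  _   = refl
funToFin-cong {suc m} f≗g = cong₂ combine (f≗g zero) (funToFin-cong (f≗g ∘ suc))

HasCard-Vector : ∀ {ℓ′} {_≈_ : Rel A ℓ′} {q} → HasCard A _≈_ q → HasCard (Vector A n) (Pointwise _≈_) (q ^ n)
HasCard-Vector {n = n} {_≈_ = _≈_} {q} finite = record
  { enum       = λ x i → enum (finToFun x i)
  ; enum-inj   = λ x y enum-x≈enum-y → begin
      x                              ≡⟨ funToFin-finToFin {n} {q} x ⟨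
      funToFin {n} {q} (finToFun x)  ≡⟨ funToFin-cong (λ i → enum-inj _ _ (enum-x≈enum-y i)) ⟩
      funToFin {n} {q} (finToFun y)  ≡⟨ funToFin-finToFin {n} {q} y ⟩
      y                              ∎
  ; index      = λ v → funToFin (index ∘ v)
  ; enum-index = λ v i → subst (λ j → enum j ≈ v i) (sym (finToFun-funToFin (index ∘ v) i)) (enum-index (v i))
  }
  where
  open HasCard finite
  open ≡-Reasoning

-- Linear combinations and linear dependence

module _ {c ℓ m ℓm} {F : CommutativeRing c ℓ} (V : Module F m ℓm) where
  open CommutativeRing F using (Carrier; _≈_; 0#; -_; _-_; -‿inverseˡ; -‿inverseʳ; +-group)
    renaming (_+_ to _+ᶠ_)
  open Module V
  open import Relation.Binary.Reasoning.Setoid ≈ᴹ-setoid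
  open import Algebra.Properties.Group +-group using (x∙y⁻¹≈ε⇒x≈y)
  open import Algebra.Properties.CommutativeSemigroup
    (Algebra.Bundles.CommutativeMonoid.commutativeSemigroup +ᴹ-commutativeMonoid) using (interchange)

  lincomb-cong : {cs ds : Vector Carrier n} (bs : Vector Carrierᴹ n) →
                 Pointwise _≈_ cs ds → lincomb V cs bs ≈ᴹ lincomb V ds bs
  lincomb-cong {zero}  bs cs≈ds = ≈ᴹ-refl
  lincomb-cong {suc n} bs cs≈ds = +ᴹ-cong (*ₗ-congʳ (cs≈ds zero)) (lincomb-cong (bs ∘ suc) (cs≈ds ∘ suc))

  lincomb-+ : (cs ds : Vector Carrier n) (bs : Vector Carrierᴹ n) →
              lincomb V (λ i → cs i +ᶠ ds i) bs ≈ᴹ lincomb V cs bs +ᴹ lincomb V ds bs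
  lincomb-+ {zero}  cs ds bs = ≈ᴹ-sym (+ᴹ-identityˡ 0ᴹ)
  lincomb-+ {suc n} cs ds bs = ≈ᴹ-trans
    (+ᴹ-cong (*ₗ-distribʳ (bs zero) (cs zero) (ds zero)) (lincomb-+ (cs ∘ suc) (ds ∘ suc) (bs ∘ suc)))
    (interchange _ _ _ _)

  lincomb-zero : {cs : Vector Carrier n} (bs : Vector Carrierᴹ n) → (∀ i → cs i ≈ 0#) → lincomb V cs bs ≈ᴹ 0ᴹ
  lincomb-zero {zero}  bs cs≈0 = ≈ᴹ-refl
  lincomb-zero {suc n} bs cs≈0 = ≈ᴹ-trans
    (+ᴹ-cong (≈ᴹ-trans (*ₗ-congʳ (cs≈0 zero)) (*ₗ-zeroˡ (bs zero))) (lincomb-zero (bs ∘ suc) (cs≈0 ∘ suc)))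
    (+ᴹ-identityˡ 0ᴹ)

  lincomb-injective : (basis : Basis V n) {cs ds : Vector Carrier n} →
                      lincomb V cs (Basis.vec basis) ≈ᴹ lincomb V ds (Basis.vec basis) → Pointwise _≈_ cs ds
  lincomb-injective {n} basis {cs} {ds} eq i =
    x∙y⁻¹≈ε⇒x≈y (cs i) (ds i) (Basis.independent basis (λ i → cs i - ds i) difference≈0 i)
    where
    bs : Vector Carrierᴹ n
    bs = Basis.vec basis
    difference≈0 : lincomb V (λ i → cs i - ds i) bs ≈ᴹ 0ᴹ
    difference≈0 = begin
      lincomb V (λ i → cs i - ds i) bs              ≈⟨ lincomb-+ cs (λ i → - ds i) bs ⟩
      lincomb V cs bs +ᴹ lincomb V (-_ ∘ ds) bs     ≈⟨ +ᴹ-congʳ eq ⟩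
      lincomb V ds bs +ᴹ lincomb V (-_ ∘ ds) bs     ≈⟨ lincomb-+ ds (λ i → - ds i) bs ⟨
      lincomb V (λ i → ds i - ds i) bs              ≈⟨ lincomb-zero bs (λ i → -‿inverseʳ (ds i)) ⟩
      0ᴹ                                            ∎

  αa+βb≈0⇒βb≈-α*ₗa : ∀ {α β a b} → α *ₗ a +ᴹ β *ₗ b ≈ᴹ 0ᴹ → β *ₗ b ≈ᴹ (- α) *ₗ a
  αa+βb≈0⇒βb≈-α*ₗa {α} {β} {a} {b} αa+βb≈0 = begin
    β *ₗ b                            ≈⟨ +ᴹ-identityˡ _ ⟨
    0ᴹ +ᴹ β *ₗ b                      ≈⟨ +ᴹ-congʳ (≈ᴹ-trans (*ₗ-congʳ (-‿inverseˡ α)) (*ₗ-zeroˡ a)) ⟨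
    (- α +ᶠ α) *ₗ a +ᴹ β *ₗ b         ≈⟨ +ᴹ-congʳ (*ₗ-distribʳ a (- α) α) ⟩
    ((- α) *ₗ a +ᴹ α *ₗ a) +ᴹ β *ₗ b  ≈⟨ +ᴹ-assoc _ _ _ ⟩
    (- α) *ₗ a +ᴹ (α *ₗ a +ᴹ β *ₗ b)  ≈⟨ +ᴹ-congˡ αa+βb≈0 ⟩
    (- α) *ₗ a +ᴹ 0ᴹ                  ≈⟨ +ᴹ-identityʳ _ ⟩
    (- α) *ₗ a                        ∎

  LinDep-sym : ∀ {a b} → LinDep V a b → LinDep V b a
  LinDep-sym ((α , β) , nontrivial , αa+βb≈0) = (β , α) , (nontrivial ∘ λ (β≈0 , α≈0) → α≈0 , β≈0) ,
    ≈ᴹ-trans (+ᴹ-comm _ _) αa+βb≈0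

  card≡card^dim : ∀ {q k} → Basis V n → HasCard Carrier _≈_ q → HasCard Carrierᴹ _≈ᴹ_ k → k ≡ q ^ n
  card≡card^dim {n} basis finF finV = ≤-antisym
    (HasCard-injective⇒≤ (≋-setoid n) finV (HasCard-Vector finF) coordinates coordinates-injective)
    (HasCard-injective⇒≤ ≈ᴹ-setoid (HasCard-Vector finF) finV (λ cs → lincomb V cs bs) (lincomb-injective basis))
    where
    open import Data.Vec.Functional.Relation.Binary.Equality.Setoid (CommutativeRing.setoid F) using (≋-setoid)
    bs : Vector Carrierᴹ n
    bs = Basis.vec basis
    coordinates : Carrierᴹ → Vector Carrier n
    coordinates v = proj₁ (Basis.spanning basis v)
    coordinates-injective : ∀ {v w} → Pointwise _≈_ (coordinates v) (coordinates w) → v ≈ᴹ w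
    coordinates-injective {v} {w} eq = begin
      v                             ≈⟨ proj₂ (Basis.spanning basis v) ⟩
      lincomb V (coordinates v) bs  ≈⟨ lincomb-cong bs eq ⟩
      lincomb V (coordinates w) bs  ≈⟨ proj₂ (Basis.spanning basis w) ⟨
      w                             ∎

module _ {c ℓ m ℓm} {F : CommutativeRing c ℓ} (isField : IsField F) (V : Module F m ℓm) where
  open CommutativeRing F using (Carrier; _≈_; 0#; 1#; -_; _-_; -‿inverseˡ; -‿inverseʳ; +-group)
    renaming (_+_ to _+ᶠ_; _*_ to _·_; *-comm to ·-comm; trans to ≈-trans)
  open IsField isField
  open Module V
  open import Relation.Binary.Reasoning.Setoid ≈ᴹ-setoid
  open import Algebra.Properties.Group +-group using (x∙y⁻¹≈ε⇒x≈y)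

  α*ₗb≈x⇒b≈α⁻¹*ₗx : ∀ {α b x} → ¬ α ≈ 0# → α *ₗ b ≈ᴹ x → ∃ λ α⁻¹ → b ≈ᴹ α⁻¹ *ₗ x
  α*ₗb≈x⇒b≈α⁻¹*ₗx {α} {b} {x} α≉0 αb≈x with inverse α α≉0
  ... | α⁻¹ , αα⁻¹≈1 = α⁻¹ , (begin
    b                ≈⟨ *ₗ-identityˡ b ⟨
    1# *ₗ b          ≈⟨ *ₗ-congʳ (≈-trans (·-comm α⁻¹ α) αα⁻¹≈1) ⟨
    (α⁻¹ · α) *ₗ b   ≈⟨ *ₗ-assoc α⁻¹ α b ⟩
    α⁻¹ *ₗ (α *ₗ b)  ≈⟨ *ₗ-congˡ αb≈x ⟩
    α⁻¹ *ₗ x         ∎)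

  α*ₗa≈0⇒a≈0 : ∀ {α a} → ¬ α ≈ 0# → α *ₗ a ≈ᴹ 0ᴹ → a ≈ᴹ 0ᴹ
  α*ₗa≈0⇒a≈0 α≉0 αa≈0 with α*ₗb≈x⇒b≈α⁻¹*ₗx α≉0 αa≈0
  ... | α⁻¹ , a≈α⁻¹0 = ≈ᴹ-trans a≈α⁻¹0 (*ₗ-zeroʳ α⁻¹)

  *ₗ-cancelʳ : (∀ x y → Dec (x ≈ y)) → ∀ {α β a} → ¬ a ≈ᴹ 0ᴹ → α *ₗ a ≈ᴹ β *ₗ a → α ≈ β
  *ₗ-cancelʳ _≟ᶠ_ {α} {β} {a} a≉0 αa≈βa with (α - β) ≟ᶠ 0#
  ... | yes α-β≈0 = x∙y⁻¹≈ε⇒x≈y α β α-β≈0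
  ... | no α-β≉0  = ⊥-elim (a≉0 (α*ₗa≈0⇒a≈0 α-β≉0 (begin
    (α - β) *ₗ a             ≈⟨ *ₗ-distribʳ a α (- β) ⟩
    α *ₗ a +ᴹ (- β) *ₗ a     ≈⟨ +ᴹ-congʳ αa≈βa ⟩
    β *ₗ a +ᴹ (- β) *ₗ a     ≈⟨ *ₗ-distribʳ a β (- β) ⟨
    (β - β) *ₗ a             ≈⟨ *ₗ-congʳ (-‿inverseʳ β) ⟩
    0# *ₗ a                  ≈⟨ *ₗ-zeroˡ a ⟩
    0ᴹ                       ∎)))

  LinDep-zeroˡ : ∀ {a b} → a ≈ᴹ 0ᴹ → LinDep V a b
  LinDep-zeroˡ {a} {b} a≈0 = (1# , 0#) , (1≉0 ∘ proj₁) ,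
    ≈ᴹ-trans (+ᴹ-cong (≈ᴹ-trans (*ₗ-identityˡ a) a≈0) (*ₗ-zeroˡ b)) (+ᴹ-identityˡ 0ᴹ)

  LinDep-*ₗ : ∀ {a b} λ′ → b ≈ᴹ λ′ *ₗ a → LinDep V a b
  LinDep-*ₗ {a} {b} λ′ b≈λa = (- λ′ , 1#) , (1≉0 ∘ proj₂) , (begin
    (- λ′) *ₗ a +ᴹ 1# *ₗ b   ≈⟨ +ᴹ-congˡ (≈ᴹ-trans (*ₗ-identityˡ b) b≈λa) ⟩
    (- λ′) *ₗ a +ᴹ λ′ *ₗ a   ≈⟨ *ₗ-distribʳ a (- λ′) λ′ ⟨
    (- λ′ +ᶠ λ′) *ₗ a        ≈⟨ *ₗ-congʳ (-‿inverseˡ λ′) ⟩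
    0# *ₗ a                  ≈⟨ *ₗ-zeroˡ a ⟩
    0ᴹ                       ∎)

  LinDep⇒*ₗ : (∀ x y → Dec (x ≈ y)) → ∀ {a b} → ¬ a ≈ᴹ 0ᴹ → LinDep V a b → ∃ λ λ′ → b ≈ᴹ λ′ *ₗ a
  LinDep⇒*ₗ _≟ᶠ_ {a} {b} a≉0 ((α , β) , nontrivial , αa+βb≈0) with β ≟ᶠ 0#
  ... | yes β≈0 = ⊥-elim (a≉0 (α*ₗa≈0⇒a≈0 (λ α≈0 → nontrivial (α≈0 , β≈0)) (begin
    α *ₗ a              ≈⟨ +ᴹ-identityʳ _ ⟨
    α *ₗ a +ᴹ 0ᴹ        ≈⟨ +ᴹ-congˡ (≈ᴹ-trans (*ₗ-congʳ β≈0) (*ₗ-zeroˡ b)) ⟨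
    α *ₗ a +ᴹ β *ₗ b    ≈⟨ αa+βb≈0 ⟩
    0ᴹ                  ∎)))
  ... | no β≉0 with α*ₗb≈x⇒b≈α⁻¹*ₗx β≉0 (αa+βb≈0⇒βb≈-α*ₗa V αa+βb≈0)
  ... | β⁻¹ , b≈β⁻¹[-αa] = β⁻¹ · (- α) , ≈ᴹ-trans b≈β⁻¹[-αa] (≈ᴹ-sym (*ₗ-assoc β⁻¹ (- α) a))

-- The linear dependence graph

module DependenceGraph {c ℓ m ℓm} {F : CommutativeRing c ℓ} (isField : IsField F)
  {q} (finF : HasCard (CommutativeRing.Carrier F) (CommutativeRing._≈_ F) q)
  (V : Module F m ℓm) {k} (finV : HasCard (Module.Carrierᴹ V) (Module._≈ᴹ_ V) k) where
  open CommutativeRing F using (0#; 1#) renaming (sym to ≈-sym)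
  open Module V
  open Decide V finF finV using (≈?F; adjacent?; edgeCount)
  private
    module Fᶠ = FiniteSetoid (CommutativeRing.setoid F) finF
    module Vᶠ = FiniteSetoid ≈ᴹ-setoid finV

  Adj : Fin k → Fin k → Set (c ⊔ ℓ ⊔ ℓm)
  Adj i j = Adjacent V (Vᶠ.enum i) (Vᶠ.enum j)

  adj? : ∀ i j → Dec (Adj i j)
  adj? i j = adjacent? (Vᶠ.enum i) (Vᶠ.enum j)

  degree : Fin k → ℕ
  degree i = count (adj? i)

  sum-degree : sum degree ≡ edgeCount + edgeCount
  sum-degree = trans (handshake adj? Adj-sym Adj-irrefl) (sym (cong₂ _+_ edgeCount≡countPairs< edgeCount≡countPairs<))
    where
    Adj-sym : ∀ {i j} → Adj i j → Adj j i
    Adj-sym (i≉j , dependent) = i≉j ∘ ≈ᴹ-sym , LinDep-sym V dependent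
    Adj-irrefl : ∀ {i} → ¬ Adj i i
    Adj-irrefl (i≉i , _) = i≉i ≈ᴹ-refl
    edgeCount≡countPairs< : edgeCount ≡ countPairs< adj?
    edgeCount≡countPairs< = trans (length-filter-cartesianProduct edge? id (allFin k))
                                  (sum-cong-≗ (λ i → length-filter-tabulate (λ j → edge? (i , j)) id))
      where
      edge? : ∀ ij → Dec (proj₁ ij < proj₂ ij × Adj (proj₁ ij) (proj₂ ij))
      edge? (i , j) = (i <? j) ×-dec adj? i j

  Adj⇒≢ : ∀ {i j} → Adj i j → j ≢ i
  Adj⇒≢ (i≉j , _) refl = i≉j ≈ᴹ-refl

  ≢∧LinDep⇒Adj : ∀ {i j} → j ≢ i → LinDep V (Vᶠ.enum i) (Vᶠ.enum j) → Adj i j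
  ≢∧LinDep⇒Adj j≢i dependent = (λ i≈j → j≢i (sym (Vᶠ.enum-inj _ _ i≈j))) , dependent

  degree-zero : ∀ {i} → Vᶠ.enum i ≈ᴹ 0ᴹ → degree i + 1 ≡ k
  degree-zero {i} i≈0 = begin
    degree i + 1                                 ≡⟨ cong (_+ 1) (count-cong ≢i adjacent (adj? i) (λ j → yes tt ×-dec ¬? (j ≟ i))) ⟩
    count (λ j → yes tt ×-dec ¬? (j ≟ i)) + 1    ≡⟨ count-remove (λ _ → yes tt) {i} tt ⟩
    count (λ (_ : Fin k) → yes tt)               ≡⟨ count-all _ (λ _ → tt) ⟩
    k                                            ∎
    where
    open ≡-Reasoning
    ≢i : ∀ {j} → Adj i j → ⊤ × j ≢ i
    ≢i adj = tt , Adj⇒≢ adj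
    adjacent : ∀ {j} → ⊤ × j ≢ i → Adj i j
    adjacent (_ , j≢i) = ≢∧LinDep⇒Adj j≢i (LinDep-zeroˡ isField V i≈0)

  degree-nonzero : ∀ {i} → ¬ Vᶠ.enum i ≈ᴹ 0ᴹ → degree i + 1 ≡ q
  degree-nonzero {i} v≉0 = begin
    degree i + 1                                  ≡⟨ cong (_+ 1) (count-cong onLine∖i adjacent (adj? i) onLine∖i?) ⟩
    count onLine∖i? + 1                           ≡⟨ count-remove onLine? i-onLine ⟩
    count onLine?                                 ≡⟨ count-image line line-injective ⟩
    q                                             ∎
    where
    open ≡-Reasoning
    v : Carrierᴹ
    v = Vᶠ.enum i
    line : Fin q → Fin k
    line l = Vᶠ.index (Fᶠ.enum l *ₗ v)
    line-injective : Injective _≡_ _≡_ line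
    line-injective eq = Fᶠ.enum-inj _ _ (*ₗ-cancelʳ isField V ≈?F v≉0 (Vᶠ.index-injective eq))
    onLine? : ∀ j → Dec (∃ λ l → j ≡ line l)
    onLine? j = any? (λ l → j ≟ line l)
    onLine∖i? : ∀ j → Dec ((∃ λ l → j ≡ line l) × j ≢ i)
    onLine∖i? j = onLine? j ×-dec ¬? (j ≟ i)
    i-onLine : ∃ λ l → i ≡ line l
    i-onLine = Fᶠ.index 1# , (begin
      i                            ≡⟨ Vᶠ.index-enum i ⟨
      Vᶠ.index v                   ≡⟨ Vᶠ.index-cong (≈ᴹ-sym (≈ᴹ-trans (*ₗ-congʳ (Fᶠ.enum-index 1#)) (*ₗ-identityˡ v))) ⟩
      line (Fᶠ.index 1#)           ∎)
    onLine∖i : ∀ {j} → Adj i j → (∃ λ l → j ≡ line l) × j ≢ i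
    onLine∖i {j} adj@(_ , dependent) with LinDep⇒*ₗ isField V ≈?F v≉0 dependent
    ... | λ′ , j≈λ′v = (Fᶠ.index λ′ , (begin
      j                            ≡⟨ Vᶠ.index-enum j ⟨
      Vᶠ.index (Vᶠ.enum j)         ≡⟨ Vᶠ.index-cong (≈ᴹ-trans j≈λ′v (*ₗ-congʳ (≈-sym (Fᶠ.enum-index λ′)))) ⟩
      line (Fᶠ.index λ′)           ∎)) , Adj⇒≢ adj
    adjacent : ∀ {j} → (∃ λ l → j ≡ line l) × j ≢ i → Adj i j
    adjacent ((l , refl) , j≢i) = ≢∧LinDep⇒Adj j≢i (LinDep-*ₗ isField V (Fᶠ.enum l) (Vᶠ.enum-index _))

  twiceEdgeCount : edgeCount + edgeCount ≡ q * (k ∸ 1)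
  twiceEdgeCount = solve-degreeSum (edgeCount + edgeCount) (Fᶠ.index 0#) i₀ (begin
    edgeCount + edgeCount + (q ∸ 1)   ≡⟨ cong (_+ (q ∸ 1)) sum-degree ⟨
    sum degree + (q ∸ 1)              ≡⟨ sum-constExcept degree i₀ (λ j j≢i₀ → m+1≡n⇒m≡n∸1 (degree-nonzero (j≢i₀ ∘ ≈0⇒≡i₀))) ⟩
    degree i₀ + k * (q ∸ 1)           ≡⟨ cong (_+ k * (q ∸ 1)) (m+1≡n⇒m≡n∸1 (degree-zero (Vᶠ.enum-index 0ᴹ))) ⟩
    (k ∸ 1) + k * (q ∸ 1)             ∎)
    where
    open ≡-Reasoning
    i₀ : Fin k
    i₀ = Vᶠ.index 0ᴹ
    ≈0⇒≡i₀ : ∀ {j} → Vᶠ.enum j ≈ᴹ 0ᴹ → j ≡ i₀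
    ≈0⇒≡i₀ {j} j≈0 = trans (sym (Vᶠ.index-enum j)) (Vᶠ.index-cong j≈0)

mainTheorem2 : {c ℓ m ℓm : Level} (F : CommutativeRing c ℓ) → IsField F →
    (q : ℕ) (FF : HasCard (CommutativeRing.Carrier F) (CommutativeRing._≈_ F) q) →
    (V : Module F m ℓm) (n : ℕ) → n ≥ 1 → HasDim V n →
    (k : ℕ) (FV : HasCard (Module.Carrierᴹ V) (Module._≈ᴹ_ V) k) →
    Decide.edgeCount V FF FV ≡ (q * (q ^ n ∸ 1)) / 2
mainTheorem2 F isField q finF V n _ basis k finV = begin
  edgeCount              ≡⟨ m+m≡n⇒n/2≡m twiceEdgeCount ⟨
  q * (k ∸ 1) / 2        ≡⟨ cong (λ N → q * (N ∸ 1) / 2) (card≡card^dim V basis finF finV) ⟩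
  q * (q ^ n ∸ 1) / 2    ∎
  where
  open ≡-Reasoning
  open DependenceGraph isField finF V finV
  open Decide V finF finV using (edgeCount)
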